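{- For $n\ge1$ let $t_n(p,q):=\sum_{w\in\mathcal F_{n,2}}p^{\mathrm{sper}(P(w))}q^{\mathrm{area}(P(w))}$. Then for all $n\ge 3$, $$t_n(p,q)=pq\,t_{n-1}(p,q)+p^3q^3\,t_{n-2}(p,q),$$ with $t_1(p,q)=p^2q+p^3q^2$ and $t_2(p,q)=p^3q^2+2p^4q^3$. Moreover, for all $n\ge 1$, $$t_n(p,q)=\sum_{i=0}^{\lfloor (n+1)/2\rfloor}\binom{n+1-i}{i}p^{n+i+1}q^{n+i}.$$
   Context: $\mathcal F_{n,2}$ denotes the set of binary words $w=w_1\cdots w_n\in\{0,1\}^n$ with no two consecutive $1$'s (Fibonacci words). To $w$ one associates the bargraph polyomino $P(w)$: the union of the unit squares $[i-1,i]\times[j-1,j]$ for $1\le i\le n$, $1\le j\le w_i+1$. $\mathrm{area}(P)$ is the number of cells of $P$ and $\mathrm{sper}(P)$ is half of the perimeter of $P$. -}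

module Defs where

open import Level using (Level)
open import Data.Bool using (Bool; true; false; not; _∧_; if_then_else_)
open import Data.Nat using (ℕ; zero; suc; _+_; _/_; _<ᵇ_)
open import Data.List using (List; []; _∷_; map; concatMap; filter; length; foldr; upTo)
open import Data.Nat.ListAction using (sum)
open import Data.Product using (_×_; _,_)
open import Algebra.Bundles using (CommutativeSemiring)

-- all binary words of length n (true = 1, false = 0)
allWords : ℕ → List (List Bool)
allWords zero    = [] ∷ []
allWords (suc n) = concatMap (λ w → (false ∷ w) ∷ (true ∷ w) ∷ []) (allWords n)

noTwoOnes : List Bool → Bool
noTwoOnes []                 = true
noTwoOnes (_ ∷ [])           = true
noTwoOnes (a ∷ b ∷ w)        = not (a ∧ b) ∧ noTwoOnes (b ∷ w)

fibWords : ℕ → List (List Bool)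
fibWords n = filter (λ w → noTwoOnes w Data.Bool.≟ true) (allWords n)

-- Bargraph polyomino P(w): column i (0-based) has height w_i + 1.
-- Cell (i , j) stands for the unit square [i,i+1] × [j,j+1].

bit : Bool → ℕ
bit false = 0
bit true  = 1

heightAt : List Bool → ℕ → ℕ
heightAt []      _       = 0
heightAt (b ∷ w) zero    = suc (bit b)
heightAt (b ∷ w) (suc i) = heightAt w i

inP : List Bool → ℕ → ℕ → Bool
inP w i j = j <ᵇ heightAt w i

cells : List Bool → List (ℕ × ℕ)
cells w = concatMap (λ i → map (λ j → (i , j)) (upTo (heightAt w i))) (upTo (length w))

missing : Bool → ℕ
missing true  = 0
missing false = 1

-- neighbour in the negative direction (coordinate 0 ⇒ outside)
missingPred : (ℕ → Bool) → ℕ → ℕ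
missingPred f zero    = 1
missingPred f (suc k) = missing (f k)

boundaryEdges : List Bool → ℕ × ℕ → ℕ
boundaryEdges w (i , j) =
  missingPred (λ k → inP w k j) i
  + missing (inP w (suc i) j)
  + missingPred (λ k → inP w i k) j
  + missing (inP w i (suc j))

area : List Bool → ℕ
area w = length (cells w)

perimeter : List Bool → ℕ
perimeter w = sum (map (boundaryEdges w) (cells w))

-- semi-perimeter (the perimeter of a polyomino is always even)
sper : List Bool → ℕ
sper w = perimeter w / 2

-- Polynomial evaluation in an arbitrary commutative semiring
-- (a polynomial identity in p, q ⇔ it holds for all p, q in every
--  commutative semiring, e.g. in ℕ[p,q] itself)

module _ {c ℓ : Level} (R : CommutativeSemiring c ℓ) where
  open CommutativeSemiring R renaming (_+_ to _+R_)

  pow : Carrier → ℕ → Carrier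
  pow x zero    = 1#
  pow x (suc k) = x * pow x k

  fromℕ : ℕ → Carrier
  fromℕ zero    = 0#
  fromℕ (suc k) = 1# +R fromℕ k

  sumR : List Carrier → Carrier
  sumR = foldr _+R_ 0#

  t : Carrier → Carrier → ℕ → Carrier
  t p q n = sumR (map (λ w → pow p (sper w) * pow q (area w)) (fibWords n))

-- A column of height 1 + b placed in front of a Fibonacci word adds 2 + 2b to the perimeter,
-- since it meets its neighbour along a single unit edge; hence sper P(w) = area P(w) + 1 and
-- t_n is the sum of p^(a+1) q^a over F_{n,2}, a being the area. Splitting a word of F_{n+2,2}
-- as 0w or 10w multiplies this weight by pq or (pq)^3, which is the recurrence. The binomial sum
-- satisfies the same recurrence by Pascal's rule (its terms vanish past i = (n+1)/2, so the range
-- may be widened) and has the same values at n = 0 and n = 1.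
module Submission where

open import Defs
open import Level using (Level)
import Data.Nat as N
open import Data.Nat using (ℕ; _≥_; _∸_; _/_)
open import Data.Nat.Combinatorics using (_C_)
open import Data.List using (map; upTo)
open import Data.Product using (_×_)
open import Algebra.Bundles using (CommutativeSemiring)

open import Data.Bool using (Bool; true; false; if_then_else_)
import Data.Bool as Bool
open import Data.List using (List; []; _∷_; _++_; filter; concatMap; length; applyUpTo)
open import Data.List.Properties
  using (map-++; map-∘; map-upTo; concatMap-map; concatMap-cong; map-concatMap; length-++; length-map; length-upTo)
open import Data.Product using (_,_; proj₁)
import Algebra.Properties.CommutativeSemigroup as CommutativeSemigroupProperties
import Algebra.Properties.CommutativeSemiring.Exp as CommutativeSemiringExp
open import Function using (_∘_)
open import Relation.Binary.PropositionalEquality as ≡ using (_≡_)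

module Polyomino where
  open import Data.Nat using (zero; suc; _+_; _*_)
  open import Data.Nat.Properties using (+-assoc)
  open import Data.Nat.DivMod using (m*n/n≡m)
  open import Data.Nat.ListAction using (sum)
  open import Data.Nat.ListAction.Properties using (sum-++)
  open import Data.Nat.Tactic.RingSolver using (solve-∀)
  open ≡ using (refl; cong; cong₂; trans)
  open ≡.≡-Reasoning

  shiftCell : ℕ × ℕ → ℕ × ℕ
  shiftCell (i , j) = (suc i , j)

  column : ℕ → ℕ → List (ℕ × ℕ)
  column i h = map (λ j → (i , j)) (upTo h)

  cells-∷ : ∀ b w → cells (b ∷ w) ≡ column 0 (suc (bit b)) ++ map shiftCell (cells w)
  cells-∷ b w = cong (column 0 (suc (bit b)) ++_) (begin
      concatMap (columnOf (b ∷ w)) (applyUpTo suc (length w))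
        ≡⟨ cong (concatMap (columnOf (b ∷ w))) (map-upTo suc (length w)) ⟨
      concatMap (columnOf (b ∷ w)) (map suc (upTo (length w)))
        ≡⟨ concatMap-map (columnOf (b ∷ w)) suc (upTo (length w)) ⟩
      concatMap (columnOf (b ∷ w) ∘ suc) (upTo (length w))
        ≡⟨ concatMap-cong (λ i → map-∘ (upTo (heightAt w i))) (upTo (length w)) ⟩
      concatMap (map shiftCell ∘ columnOf w) (upTo (length w))
        ≡⟨ map-concatMap shiftCell (columnOf w) (upTo (length w)) ⟨
      map shiftCell (cells w) ∎)
    where
    columnOf : List Bool → ℕ → List (ℕ × ℕ)
    columnOf w i = column i (heightAt w i)

  area-∷ : ∀ b w → area (b ∷ w) ≡ suc (bit b) + area w
  area-∷ b w = begin
    length (cells (b ∷ w))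
      ≡⟨ cong length (cells-∷ b w) ⟩
    length (column 0 (suc (bit b)) ++ map shiftCell (cells w))
      ≡⟨ length-++ (column 0 (suc (bit b))) ⟩
    length (column 0 (suc (bit b))) + length (map shiftCell (cells w))
      ≡⟨ cong₂ _+_ (trans (length-map _ (upTo (suc (bit b)))) (length-upTo (suc (bit b))))
                   (length-map shiftCell (cells w)) ⟩
    suc (bit b) + area w ∎

  sum-cells-∷ : ∀ (g : ℕ × ℕ → ℕ) b w →
    sum (map g (cells (b ∷ w))) ≡ sum (map g (column 0 (suc (bit b)))) + sum (map (g ∘ shiftCell) (cells w))
  sum-cells-∷ g b w = begin
    sum (map g (cells (b ∷ w)))
      ≡⟨ cong (sum ∘ map g) (cells-∷ b w) ⟩
    sum (map g (column 0 (suc (bit b)) ++ map shiftCell (cells w)))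
      ≡⟨ cong sum (map-++ g (column 0 (suc (bit b))) (map shiftCell (cells w))) ⟩
    sum (map g (column 0 (suc (bit b))) ++ map g (map shiftCell (cells w)))
      ≡⟨ sum-++ (map g (column 0 (suc (bit b)))) _ ⟩
    sum (map g (column 0 (suc (bit b)))) + sum (map g (map shiftCell (cells w)))
      ≡⟨ cong (λ xs → sum (map g (column 0 (suc (bit b)))) + sum xs) (map-∘ (cells w)) ⟨
    sum (map g (column 0 (suc (bit b)))) + sum (map (g ∘ shiftCell) (cells w)) ∎

  -- The new column has 2 + 2 (1 + b) edges; as b c ≠ 1 1 it shares exactly one unit edge with
  -- its neighbour, which thereby leaves the boundary on both sides.
  front-columns-boundary : ∀ b c w → noTwoOnes (b ∷ c ∷ w) ≡ true →
    sum (map (boundaryEdges (b ∷ c ∷ w)) (column 0 (suc (bit b))))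
      + sum (map (boundaryEdges (b ∷ c ∷ w) ∘ shiftCell) (column 0 (suc (bit c))))
    ≡ 2 + 2 * bit b + sum (map (boundaryEdges (c ∷ w)) (column 0 (suc (bit c))))
  front-columns-boundary false false []          _ = refl
  front-columns-boundary false false (false ∷ w) _ = refl
  front-columns-boundary false false (true ∷ w)  _ = refl
  front-columns-boundary false true  []          _ = refl
  front-columns-boundary false true  (false ∷ w) _ = refl
  front-columns-boundary true  false []          _ = refl
  front-columns-boundary true  false (false ∷ w) _ = refl
  front-columns-boundary true  false (true ∷ w)  _ = refl

  perimeter-∷∷ : ∀ b c w → noTwoOnes (b ∷ c ∷ w) ≡ true →
    perimeter (b ∷ c ∷ w) ≡ 2 + 2 * bit b + perimeter (c ∷ w)
  perimeter-∷∷ b c w fib = begin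
    perimeter (b ∷ c ∷ w)
      ≡⟨ sum-cells-∷ E b (c ∷ w) ⟩
    firstColumn + sum (map (E ∘ shiftCell) (cells (c ∷ w)))
      ≡⟨ cong (firstColumn +_) (sum-cells-∷ (E ∘ shiftCell) c w) ⟩
    firstColumn + (secondColumn + rest)
      ≡⟨ +-assoc firstColumn secondColumn rest ⟨
    (firstColumn + secondColumn) + rest
      ≡⟨ cong (_+ rest) (front-columns-boundary b c w fib) ⟩
    (2 + 2 * bit b + sum (map E′ (column 0 (suc (bit c))))) + rest
      ≡⟨ +-assoc (2 + 2 * bit b) _ rest ⟩
    2 + 2 * bit b + (sum (map E′ (column 0 (suc (bit c)))) + rest)
      ≡⟨ cong (2 + 2 * bit b +_) (sum-cells-∷ E′ c w) ⟨
    2 + 2 * bit b + perimeter (c ∷ w) ∎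
    where
    E E′ : ℕ × ℕ → ℕ
    E  = boundaryEdges (b ∷ c ∷ w)
    E′ = boundaryEdges (c ∷ w)
    firstColumn secondColumn rest : ℕ
    firstColumn  = sum (map E (column 0 (suc (bit b))))
    secondColumn = sum (map (E ∘ shiftCell) (column 0 (suc (bit c))))
    rest         = sum (map (E′ ∘ shiftCell) (cells w))

  noTwoOnes-tail : ∀ b c w → noTwoOnes (b ∷ c ∷ w) ≡ true → noTwoOnes (c ∷ w) ≡ true
  noTwoOnes-tail false c     w fib = fib
  noTwoOnes-tail true  false w fib = fib

  perimeter-∷ : ∀ b w → noTwoOnes (b ∷ w) ≡ true → perimeter (b ∷ w) ≡ (area (b ∷ w) + 1) * 2
  perimeter-∷ false []      _   = refl
  perimeter-∷ true  []      _   = refl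
  perimeter-∷ b     (c ∷ w) fib = begin
    perimeter (b ∷ c ∷ w)                    ≡⟨ perimeter-∷∷ b c w fib ⟩
    2 + 2 * bit b + perimeter (c ∷ w)        ≡⟨ cong (2 + 2 * bit b +_) (perimeter-∷ c w (noTwoOnes-tail b c w fib)) ⟩
    2 + 2 * bit b + (area (c ∷ w) + 1) * 2   ≡⟨ regroup (bit b) (area (c ∷ w)) ⟩
    (suc (bit b) + area (c ∷ w) + 1) * 2     ≡⟨ cong (λ a → (a + 1) * 2) (area-∷ b (c ∷ w)) ⟨
    (area (b ∷ c ∷ w) + 1) * 2               ∎
    where
    regroup : ∀ x a → 2 + 2 * x + (a + 1) * 2 ≡ (suc x + a + 1) * 2
    regroup = solve-∀

  sper-∷ : ∀ b w → noTwoOnes (b ∷ w) ≡ true → sper (b ∷ w) ≡ area (b ∷ w) + 1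
  sper-∷ b w fib = trans (cong (_/ 2) (perimeter-∷ b w fib)) (m*n/n≡m (area (b ∷ w) + 1) 2)

  noTwoOnes-false∷ : ∀ w → noTwoOnes (false ∷ w) ≡ noTwoOnes w
  noTwoOnes-false∷ []      = refl
  noTwoOnes-false∷ (_ ∷ _) = refl

module Binomial where
  open import Data.Nat using (zero; suc; _+_; _*_; _<_; _≤_; z≤n; s≤s; ≢-nonZero)
  open import Data.Nat.Properties
    using (+-comm; +-identityʳ; *-comm; m≤n⇒m≤1+n; <⇒≱; ≰⇒>; m<n⇒n≢0; m<n+o⇒m∸n<o)
  open import Data.Nat.DivMod using (m/n<m; m*n/n≡m; /-monoˡ-≤)
  open import Data.Nat.Combinatorics using (nCk+nC[k+1]≡[n+1]C[k+1]; k>n⇒nCk≡0)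
  open ≡ using (refl; trans; sym; cong; subst)

  C-pascal : ∀ m {i k} → i ≤ k → (suc m ∸ i) C suc k ≡ (m ∸ i) C suc k + (m ∸ i) C k
  C-pascal m       {zero}        {k}     _         = trans (sym (nCk+nC[k+1]≡[n+1]C[k+1] m k)) (+-comm (m C k) (m C suc k))
  C-pascal zero    {suc zero}    {suc k} _         = refl
  C-pascal zero    {suc (suc i)} {suc k} _         = refl
  C-pascal (suc m) {suc i}       {suc k} (s≤s i≤k) = C-pascal m (m≤n⇒m≤1+n i≤k)

  C-vanishes : ∀ m i → m / 2 + 1 ≤ i → (m ∸ i) C i ≡ 0
  C-vanishes m i limit≤i = k>n⇒nCk≡0 (m<n+o⇒m∸n<o m i {{≢-nonZero (m<n⇒n≢0 m/2<i)}} m<i+i)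
    where
    m/2<i : m / 2 < i
    m/2<i = subst (_≤ i) (+-comm (m / 2) 1) limit≤i
    i+i≡i*2 : i + i ≡ i * 2
    i+i≡i*2 = sym (trans (*-comm i 2) (cong (i +_) (+-identityʳ i)))
    m<i+i : m < i + i
    m<i+i = ≰⇒> λ i+i≤m → <⇒≱ m/2<i
      (subst (_≤ m / 2) (trans (cong (_/ 2) i+i≡i*2) (m*n/n≡m i 2)) (/-monoˡ-≤ 2 i+i≤m))

  upperLimit-≤ : ∀ n → (n + 1) / 2 + 1 ≤ suc n
  upperLimit-≤ n rewrite +-comm n 1 | +-comm (suc n / 2) 1 = m/n<m (suc n) 2 (s≤s (s≤s z≤n))

module Summation {c ℓ : Level} (R : CommutativeSemiring c ℓ) where
  open import Data.Nat using (zero; suc; _≤_; z≤n; s≤s)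
  open CommutativeSemiring R
  open CommutativeSemigroupProperties +-commutativeSemigroup using (interchange)
  open Polyomino using (noTwoOnes-false∷)
  open import Relation.Binary.Reasoning.Setoid setoid

  sumOver : {A : Set} → List A → (A → Carrier) → Carrier
  sumOver xs f = sumR R (map f xs)

  infixl 10 sumOver
  syntax sumOver xs (λ x → e) = ∑[ x ∈ xs ] e

  module _ {A : Set} where

    ∑-cong : {f g : A → Carrier} → (∀ x → f x ≈ g x) → ∀ xs → ∑[ x ∈ xs ] f x ≈ ∑[ x ∈ xs ] g x
    ∑-cong f≈g []       = refl
    ∑-cong f≈g (x ∷ xs) = +-cong (f≈g x) (∑-cong f≈g xs)

    ∑-zero : ∀ (xs : List A) → ∑[ x ∈ xs ] 0# ≈ 0#
    ∑-zero []       = refl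
    ∑-zero (x ∷ xs) = trans (+-identityˡ _) (∑-zero xs)

    ∑-distrib-+ : ∀ (f g : A → Carrier) xs → ∑[ x ∈ xs ] (f x + g x) ≈ ∑[ x ∈ xs ] f x + ∑[ x ∈ xs ] g x
    ∑-distrib-+ f g []       = sym (+-identityˡ 0#)
    ∑-distrib-+ f g (x ∷ xs) = trans (+-congˡ (∑-distrib-+ f g xs)) (interchange _ _ _ _)

    ∑-distribˡ : ∀ k (f : A → Carrier) xs → ∑[ x ∈ xs ] (k * f x) ≈ k * ∑[ x ∈ xs ] f x
    ∑-distribˡ k f []       = sym (zeroʳ k)
    ∑-distribˡ k f (x ∷ xs) = trans (+-congˡ (∑-distribˡ k f xs)) (sym (distribˡ k _ _))

    ∑-filter : ∀ (P : A → Bool) (f : A → Carrier) xs →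
      ∑[ x ∈ filter (λ x → P x Bool.≟ true) xs ] f x ≈ ∑[ x ∈ xs ] (if P x then f x else 0#)
    ∑-filter P f []       = refl
    ∑-filter P f (x ∷ xs) with P x
    ... | true  = +-congˡ (∑-filter P f xs)
    ... | false = trans (∑-filter P f xs) (sym (+-identityˡ _))

  ∑-allWords-suc : ∀ (f : List Bool → Carrier) n →
    ∑[ w ∈ allWords (suc n) ] f w ≈ ∑[ w ∈ allWords n ] f (false ∷ w) + ∑[ w ∈ allWords n ] f (true ∷ w)
  ∑-allWords-suc f n = go (allWords n)
    where
    go : ∀ ws → ∑[ w ∈ concatMap (λ w → (false ∷ w) ∷ (true ∷ w) ∷ []) ws ] f w
                ≈ ∑[ w ∈ ws ] f (false ∷ w) + ∑[ w ∈ ws ] f (true ∷ w)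
    go []       = sym (+-identityˡ 0#)
    go (w ∷ ws) = trans (sym (+-assoc _ _ _)) (trans (+-congˡ (go ws)) (interchange _ _ _ _))

  ∑-upTo-suc : ∀ (f : ℕ → Carrier) M → ∑[ i ∈ upTo (suc M) ] f i ≈ f 0 + ∑[ i ∈ upTo M ] f (suc i)
  ∑-upTo-suc f M = reflexive (≡.cong (sumR R) (≡.trans (map-upTo f (suc M))
                                                (≡.cong (f 0 ∷_) (≡.sym (map-upTo (f ∘ suc) M)))))

  ∑-upTo-truncate : ∀ (f : ℕ → Carrier) {K M} → K ≤ M → (∀ i → K ≤ i → f i ≈ 0#) →
    ∑[ i ∈ upTo M ] f i ≈ ∑[ i ∈ upTo K ] f i
  ∑-upTo-truncate f {zero} {M} _ vanish = trans (∑-cong (λ i → vanish i z≤n) (upTo M)) (∑-zero (upTo M))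
  ∑-upTo-truncate f {suc K} {suc M} (s≤s K≤M) vanish = begin
    ∑[ i ∈ upTo (suc M) ] f i             ≈⟨ ∑-upTo-suc f M ⟩
    f 0 + ∑[ i ∈ upTo M ] f (suc i)       ≈⟨ +-congˡ (∑-upTo-truncate (f ∘ suc) K≤M (λ i K≤i → vanish (suc i) (s≤s K≤i))) ⟩
    f 0 + ∑[ i ∈ upTo K ] f (suc i)       ≈⟨ ∑-upTo-suc f K ⟨
    ∑[ i ∈ upTo (suc K) ] f i             ∎

  restrictFib : (List Bool → Carrier) → List Bool → Carrier
  restrictFib f w = if noTwoOnes w then f w else 0#

  ∑-fibWords-suc : ∀ (f : List Bool → Carrier) n →
    ∑[ w ∈ fibWords (suc n) ] f w ≈ ∑[ w ∈ allWords n ] restrictFib f (false ∷ w) + ∑[ w ∈ allWords n ] restrictFib f (true ∷ w)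
  ∑-fibWords-suc f n = trans (∑-filter noTwoOnes f (allWords (suc n))) (∑-allWords-suc (restrictFib f) n)

  ∑-fibWords-cong-∷ : ∀ {f g : List Bool → Carrier} → (∀ b w → noTwoOnes (b ∷ w) ≡ true → f (b ∷ w) ≈ g (b ∷ w)) →
    ∀ n → ∑[ w ∈ fibWords (suc n) ] f w ≈ ∑[ w ∈ fibWords (suc n) ] g w
  ∑-fibWords-cong-∷ {f} {g} f≈g n = begin
    ∑[ w ∈ fibWords (suc n) ] f w
      ≈⟨ ∑-fibWords-suc f n ⟩
    ∑[ w ∈ allWords n ] restrictFib f (false ∷ w) + ∑[ w ∈ allWords n ] restrictFib f (true ∷ w)
      ≈⟨ +-cong (∑-cong (restrictFib-cong false) (allWords n)) (∑-cong (restrictFib-cong true) (allWords n)) ⟩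
    ∑[ w ∈ allWords n ] restrictFib g (false ∷ w) + ∑[ w ∈ allWords n ] restrictFib g (true ∷ w)
      ≈⟨ ∑-fibWords-suc g n ⟨
    ∑[ w ∈ fibWords (suc n) ] g w ∎
    where
    restrictFib-cong : ∀ b w → restrictFib f (b ∷ w) ≈ restrictFib g (b ∷ w)
    restrictFib-cong b w with noTwoOnes (b ∷ w) in fib
    ... | true  = f≈g b w fib
    ... | false = refl

  ∑-restrictFib-false∷ : ∀ (f : List Bool → Carrier) n →
    ∑[ w ∈ allWords n ] restrictFib f (false ∷ w) ≈ ∑[ w ∈ fibWords n ] f (false ∷ w)
  ∑-restrictFib-false∷ f n = trans (∑-cong unfold (allWords n)) (sym (∑-filter noTwoOnes (f ∘ (false ∷_)) (allWords n)))
    where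
    unfold : ∀ w → restrictFib f (false ∷ w) ≈ restrictFib (f ∘ (false ∷_)) w
    unfold w rewrite noTwoOnes-false∷ w = refl

  ∑-fibWords-recurrence : ∀ α β (f : List Bool → Carrier) →
    (∀ w → f (false ∷ w) ≈ α * f w) → (∀ w → f (true ∷ false ∷ w) ≈ β * f w) →
    ∀ n → ∑[ w ∈ fibWords (suc (suc n)) ] f w
          ≈ α * ∑[ w ∈ fibWords (suc n) ] f w + β * ∑[ w ∈ fibWords n ] f w
  ∑-fibWords-recurrence α β f f-0∷ f-10∷ n = begin
    ∑[ w ∈ fibWords (suc (suc n)) ] f w
      ≈⟨ ∑-fibWords-suc f (suc n) ⟩
    ∑[ w ∈ allWords (suc n) ] restrictFib f (false ∷ w) + ∑[ w ∈ allWords (suc n) ] restrictFib f (true ∷ w)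
      ≈⟨ +-congˡ (∑-allWords-suc (restrictFib f ∘ (true ∷_)) n) ⟩
    ∑[ w ∈ allWords (suc n) ] restrictFib f (false ∷ w)
      + (∑[ w ∈ allWords n ] restrictFib f (true ∷ false ∷ w) + ∑[ w ∈ allWords n ] 0#)
      ≈⟨ +-cong (∑-restrictFib-false∷ f (suc n)) (trans (+-congˡ (∑-zero (allWords n))) (+-identityʳ _)) ⟩
    ∑[ w ∈ fibWords (suc n) ] f (false ∷ w) + ∑[ w ∈ allWords n ] restrictFib f (true ∷ false ∷ w)
      ≈⟨ +-congˡ (∑-restrictFib-false∷ (f ∘ (true ∷_)) n) ⟩
    ∑[ w ∈ fibWords (suc n) ] f (false ∷ w) + ∑[ w ∈ fibWords n ] f (true ∷ false ∷ w)
      ≈⟨ +-cong (∑-cong f-0∷ (fibWords (suc n))) (∑-cong f-10∷ (fibWords n)) ⟩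
    ∑[ w ∈ fibWords (suc n) ] (α * f w) + ∑[ w ∈ fibWords n ] (β * f w)
      ≈⟨ +-cong (∑-distribˡ α f (fibWords (suc n))) (∑-distribˡ β f (fibWords n)) ⟩
    α * ∑[ w ∈ fibWords (suc n) ] f w + β * ∑[ w ∈ fibWords n ] f w ∎

  recurrence-unique : ∀ α β (f g : ℕ → Carrier) →
    (∀ n → f (suc (suc n)) ≈ α * f (suc n) + β * f n) →
    (∀ n → g (suc (suc n)) ≈ α * g (suc n) + β * g n) →
    f 0 ≈ g 0 → f 1 ≈ g 1 → ∀ n → f n ≈ g n
  recurrence-unique α β f g f-rec g-rec f₀≈g₀ f₁≈g₁ n = proj₁ (agree n)
    where
    agree : ∀ n → f n ≈ g n × f (suc n) ≈ g (suc n)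
    agree zero    = f₀≈g₀ , f₁≈g₁
    agree (suc n) with agree n
    ... | fₙ≈gₙ , fₙ₊₁≈gₙ₊₁ = fₙ₊₁≈gₙ₊₁ , (begin
      f (suc (suc n))           ≈⟨ f-rec n ⟩
      α * f (suc n) + β * f n   ≈⟨ +-cong (*-congˡ fₙ₊₁≈gₙ₊₁) (*-congˡ fₙ≈gₙ) ⟩
      α * g (suc n) + β * g n   ≈⟨ g-rec n ⟨
      g (suc (suc n))           ∎)

  fromℕ-+ : ∀ m n → fromℕ R (m N.+ n) ≈ fromℕ R m + fromℕ R n
  fromℕ-+ zero    n = sym (+-identityˡ (fromℕ R n))
  fromℕ-+ (suc m) n = trans (+-congˡ (fromℕ-+ m n)) (sym (+-assoc 1# _ _))

  fromℕ-suc-* : ∀ k x → fromℕ R (suc k) * x ≈ x + fromℕ R k * x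
  fromℕ-suc-* k x = trans (distribʳ x 1# (fromℕ R k)) (+-congʳ (*-identityˡ x))

  fromℕ-1-* : ∀ x → fromℕ R 1 * x ≈ x
  fromℕ-1-* x = trans (fromℕ-suc-* 0 x) (trans (+-congˡ (zeroˡ x)) (+-identityʳ x))

  fromℕ-2-* : ∀ x → fromℕ R 2 * x ≈ x + (x + 0#)
  fromℕ-2-* x = trans (fromℕ-suc-* 1 x) (+-congˡ (trans (fromℕ-1-* x) (sym (+-identityʳ x))))

module Series {c ℓ : Level} (R : CommutativeSemiring c ℓ) (p q : CommutativeSemiring.Carrier R) where
  open import Data.Nat using (zero; suc; _≤_)
  open import Data.Nat.Properties using (+-suc; ≤-trans; n≤1+n; ≤-refl)
  open CommutativeSemiring R
  open CommutativeSemigroupProperties *-commutativeSemigroup using (interchange; x∙yz≈y∙xz)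
  open CommutativeSemiringExp R using (^-distrib-*)
  open Summation R
  open Polyomino using (area-∷; sper-∷)
  open Binomial using (C-pascal; C-vanishes; upperLimit-≤)
  open import Relation.Binary.Reasoning.Setoid setoid

  β : Carrier
  β = pow R p 3 * pow R q 3

  monomial : ℕ → Carrier
  monomial a = pow R p (a N.+ 1) * pow R q a

  monomial-suc : ∀ a → monomial (suc a) ≈ (p * q) * monomial a
  monomial-suc a = interchange p (pow R p (a N.+ 1)) q (pow R q a)

  monomial-+ : ∀ k a → monomial (k N.+ a) ≈ pow R (p * q) k * monomial a
  monomial-+ zero    a = sym (*-identityˡ (monomial a))
  monomial-+ (suc k) a = begin
    monomial (suc (k N.+ a))                 ≈⟨ monomial-suc (k N.+ a) ⟩
    (p * q) * monomial (k N.+ a)             ≈⟨ *-congˡ (monomial-+ k a) ⟩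
    (p * q) * (pow R (p * q) k * monomial a) ≈⟨ *-assoc (p * q) _ _ ⟨
    pow R (p * q) (suc k) * monomial a       ∎

  monomial-3+ : ∀ a → monomial (3 N.+ a) ≈ β * monomial a
  monomial-3+ a = trans (monomial-+ 3 a) (*-congʳ (^-distrib-* p q 3))

  term : ℕ → ℕ → Carrier
  term n i = fromℕ R ((n N.+ 1 ∸ i) C i) * monomial (n N.+ i)

  closedSum : ℕ → ℕ → Carrier
  closedSum n M = ∑[ i ∈ upTo M ] term n i

  closedForm : ℕ → Carrier
  closedForm n = closedSum n ((n N.+ 1) / 2 N.+ 1)

  term-0 : ∀ n → term (suc (suc n)) 0 ≈ (p * q) * term (suc n) 0
  term-0 n = trans (*-congˡ (monomial-suc (suc (n N.+ 0)))) (x∙yz≈y∙xz (fromℕ R 1) (p * q) _)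

  term-suc : ∀ n i → term (suc (suc n)) (suc i) ≈ (p * q) * term (suc n) (suc i) + β * term n i
  term-suc n i = begin
    term (suc (suc n)) (suc i)
      ≈⟨ reflexive (≡.cong₂ (λ c k → fromℕ R c * monomial k) (C-pascal (n N.+ 1) (≤-refl {i})) (≡.cong (2 N.+_) k≡)) ⟩
    fromℕ R (x N.+ y) * monomial (3 N.+ k)
      ≈⟨ *-congʳ (fromℕ-+ x y) ⟩
    (fromℕ R x + fromℕ R y) * monomial (3 N.+ k)
      ≈⟨ distribʳ _ (fromℕ R x) (fromℕ R y) ⟩
    fromℕ R x * monomial (3 N.+ k) + fromℕ R y * monomial (3 N.+ k)
      ≈⟨ +-cong (*-congˡ (monomial-suc (2 N.+ k))) (*-congˡ (monomial-3+ k)) ⟩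
    fromℕ R x * ((p * q) * monomial (2 N.+ k)) + fromℕ R y * (β * monomial k)
      ≈⟨ +-cong (x∙yz≈y∙xz (fromℕ R x) (p * q) _) (x∙yz≈y∙xz (fromℕ R y) β _) ⟩
    (p * q) * (fromℕ R x * monomial (2 N.+ k)) + β * (fromℕ R y * monomial k)
      ≈⟨ reflexive (≡.cong (λ k → (p * q) * (fromℕ R x * monomial (suc k)) + β * term n i) k≡) ⟨
    (p * q) * term (suc n) (suc i) + β * term n i ∎
    where
    x y k : ℕ
    x = (n N.+ 1 ∸ i) C suc i
    y = (n N.+ 1 ∸ i) C i
    k = n N.+ i
    k≡ : n N.+ suc i ≡ suc k
    k≡ = +-suc n i

  closedSum-recurrence : ∀ n M →
    closedSum (suc (suc n)) (suc M) ≈ (p * q) * closedSum (suc n) (suc M) + β * closedSum n M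
  closedSum-recurrence n M = begin
    closedSum (suc (suc n)) (suc M)
      ≈⟨ ∑-upTo-suc (term (suc (suc n))) M ⟩
    term (suc (suc n)) 0 + ∑[ i ∈ upTo M ] term (suc (suc n)) (suc i)
      ≈⟨ +-cong (term-0 n) (∑-cong (term-suc n) (upTo M)) ⟩
    (p * q) * term (suc n) 0 + ∑[ i ∈ upTo M ] ((p * q) * term (suc n) (suc i) + β * term n i)
      ≈⟨ +-congˡ (∑-distrib-+ _ _ (upTo M)) ⟩
    (p * q) * term (suc n) 0 + (∑[ i ∈ upTo M ] ((p * q) * term (suc n) (suc i)) + ∑[ i ∈ upTo M ] (β * term n i))
      ≈⟨ +-congˡ (+-cong (∑-distribˡ (p * q) _ (upTo M)) (∑-distribˡ β _ (upTo M))) ⟩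
    (p * q) * term (suc n) 0 + ((p * q) * ∑[ i ∈ upTo M ] term (suc n) (suc i) + β * closedSum n M)
      ≈⟨ +-assoc _ _ _ ⟨
    ((p * q) * term (suc n) 0 + (p * q) * ∑[ i ∈ upTo M ] term (suc n) (suc i)) + β * closedSum n M
      ≈⟨ +-congʳ (distribˡ (p * q) _ _) ⟨
    (p * q) * (term (suc n) 0 + ∑[ i ∈ upTo M ] term (suc n) (suc i)) + β * closedSum n M
      ≈⟨ +-congʳ (*-congˡ (∑-upTo-suc (term (suc n)) M)) ⟨
    (p * q) * closedSum (suc n) (suc M) + β * closedSum n M ∎

  closedSum-stable : ∀ n {M} → suc n ≤ M → closedSum n M ≈ closedForm n
  closedSum-stable n n<M = ∑-upTo-truncate (term n) (≤-trans (upperLimit-≤ n) n<M) vanish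
    where
    vanish : ∀ i → (n N.+ 1) / 2 N.+ 1 ≤ i → term n i ≈ 0#
    vanish i limit≤i = trans (*-congʳ (reflexive (≡.cong (fromℕ R) (C-vanishes (n N.+ 1) i limit≤i)))) (zeroˡ _)

  closedForm-recurrence : ∀ n →
    closedForm (suc (suc n)) ≈ (p * q) * closedForm (suc n) + β * closedForm n
  closedForm-recurrence n = begin
    closedForm (suc (suc n))
      ≈⟨ closedSum-stable (suc (suc n)) ≤-refl ⟨
    closedSum (suc (suc n)) (suc (suc (suc n)))
      ≈⟨ closedSum-recurrence n (suc (suc n)) ⟩
    (p * q) * closedSum (suc n) (suc (suc (suc n))) + β * closedSum n (suc (suc n))
      ≈⟨ +-cong (*-congˡ (closedSum-stable (suc n) (n≤1+n _))) (*-congˡ (closedSum-stable n (n≤1+n _))) ⟩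
    (p * q) * closedForm (suc n) + β * closedForm n ∎

  -- Equal to t only from length 1 on: the empty word has semi-perimeter 0, not area + 1.
  fibSum : ℕ → Carrier
  fibSum n = ∑[ w ∈ fibWords n ] monomial (area w)

  fibSum-recurrence : ∀ n → fibSum (suc (suc n)) ≈ (p * q) * fibSum (suc n) + β * fibSum n
  fibSum-recurrence = ∑-fibWords-recurrence (p * q) β (monomial ∘ area)
    (λ w → trans (reflexive (≡.cong monomial (area-∷ false w))) (monomial-suc (area w)))
    (λ w → trans (reflexive (≡.cong monomial (≡.trans (area-∷ true (false ∷ w)) (≡.cong (2 N.+_) (area-∷ false w)))))
                 (monomial-3+ (area w)))

  fibSum≈closedForm : ∀ n → fibSum n ≈ closedForm n
  fibSum≈closedForm = recurrence-unique (p * q) β fibSum closedForm fibSum-recurrence closedForm-recurrence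
    (+-congʳ (sym (fromℕ-1-* _)))
    (+-cong (sym (fromℕ-1-* _)) (+-congʳ (sym (fromℕ-1-* _))))

  t≈fibSum : ∀ n → t R p q (suc n) ≈ fibSum (suc n)
  t≈fibSum = ∑-fibWords-cong-∷ λ b w fib → reflexive (≡.cong (λ s → pow R p s * pow R q (area (b ∷ w))) (sper-∷ b w fib))

  t-recurrence : ∀ n → t R p q (3 N.+ n) ≈ (p * q) * t R p q (2 N.+ n) + β * t R p q (1 N.+ n)
  t-recurrence n = begin
    t R p q (3 N.+ n)                                  ≈⟨ t≈fibSum (2 N.+ n) ⟩
    fibSum (3 N.+ n)                                   ≈⟨ fibSum-recurrence (1 N.+ n) ⟩
    (p * q) * fibSum (2 N.+ n) + β * fibSum (1 N.+ n)  ≈⟨ +-cong (*-congˡ (t≈fibSum (1 N.+ n))) (*-congˡ (t≈fibSum n)) ⟨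
    (p * q) * t R p q (2 N.+ n) + β * t R p q (1 N.+ n) ∎

theorem1p3 : {c ℓ : Level} (R : CommutativeSemiring c ℓ) →
    let open CommutativeSemiring R in
    (p q : Carrier) →
      ((n : ℕ) → n ≥ 3 →
        t R p q n ≈ (p * q) * t R p q (n ∸ 1) + (pow R p 3 * pow R q 3) * t R p q (n ∸ 2))
      × t R p q 1 ≈ pow R p 2 * q + pow R p 3 * pow R q 2
      × t R p q 2 ≈ pow R p 3 * pow R q 2 + fromℕ R 2 * (pow R p 4 * pow R q 3)
      × ((n : ℕ) → n ≥ 1 →
        t R p q n ≈ sumR R (map (λ i → fromℕ R ((n N.+ 1 ∸ i) C i) * (pow R p (n N.+ i N.+ 1) * pow R q (n N.+ i)))
                               (upTo ((n N.+ 1) / 2 N.+ 1))))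
theorem1p3 R p q = recurrence , t₁ , t₂ , closed
  where
  open CommutativeSemiring R
  open Summation R using (fromℕ-2-*)
  open Series R p q
  recurrence : (n : ℕ) → n ≥ 3 → t R p q n ≈ (p * q) * t R p q (n ∸ 1) + β * t R p q (n ∸ 2)
  recurrence 1                         (N.s≤s ())
  recurrence 2                         (N.s≤s (N.s≤s ()))
  recurrence (N.suc (N.suc (N.suc n))) _ = t-recurrence n
  t₁ : t R p q 1 ≈ pow R p 2 * q + pow R p 3 * pow R q 2
  t₁ = trans (t≈fibSum 0) (+-cong (*-congˡ (*-identityʳ q)) (+-identityʳ _))
  t₂ : t R p q 2 ≈ pow R p 3 * pow R q 2 + fromℕ R 2 * (pow R p 4 * pow R q 3)
  t₂ = trans (t≈fibSum 1) (+-congˡ (sym (fromℕ-2-* _)))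
  closed : (n : ℕ) → n ≥ 1 → t R p q n ≈ closedForm n
  closed (N.suc n) _ = trans (t≈fibSum n) (fibSum≈closedForm (N.suc n))
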